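{- For every natural number $n\ge1$ and every balanced $\mathsf{HS}$ formula $\psi$ over $\{p\}$ with $|\psi|\le n$: $K_n\models_{\mathsf{st}}\psi$ if and only if $M_n\models_{\mathsf{st}}\psi$.
   Context: For $n\ge1$, let $S_n=\{s_0,s_1,\dots,s_{2n},t\}$, $\delta_n=\{(s_0,s_0),(s_0,s_1),(s_1,s_2),\dots,(s_{2n-1},s_{2n}),(s_{2n},t),(t,t)\}$, $\mu_n(s_i)=\emptyset$ for $0\le i\le 2n$ and $\mu_n(t)=\{p\}$. $K_n=(\{p\},S_n,\delta_n,\mu_n,s_0)$ and $M_n=(\{p\},S_n,\delta_n,\mu_n,s_1)$ (Kripke structures differing only in the initial state). A trace of a Kripke structure is a non-empty finite sequence of states following the transition relation; it is initial if it starts at the initial state. $\mathsf{HS}$ formulas: $\psi::=p\mid\neg\psi\mid\psi\wedge\psi\mid\langle B\rangle\psi\mid\langle E\rangle\psi\mid\langle\overline{B}\rangle\psi\mid\langle\overline{E}\rangle\psi$; $|\psi|$ is the number of symbols of $\psi$. $\psi$ is balanced if for every subformula of the form $\langle B\rangle\theta$ or $\langle\overline{B}\rangle\theta$, $\theta=\theta_1\wedge\theta_2$ with $|\theta_1|=|\theta_2|$. State-based semantics on traces $\rho$: $\rho\models p$ iff $p$ labels every state of $\rho$; $\rho\models\langle B\rangle\psi$ / $\langle E\rangle\psi$ iff some proper non-empty prefix / suffix of $\rho$ satisfies $\psi$; $\rho\models\langle\overline{B}\rangle\psi$ / $\langle\overline{E}\rangle\psi$ iff some trace having $\rho$ as proper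 prefix / suffix satisfies $\psi$. $K\models_{\mathsf{st}}\psi$ iff every initial trace of $K$ satisfies $\psi$. -}

module Defs where

open import Data.Nat using (ℕ; zero; suc; _+_; _*_)
open import Data.Fin using (Fin; toℕ) renaming (zero to fzero; suc to fsuc)
open import Data.List using (List; []; _∷_; _++_)
open import Data.List.Relation.Unary.All using (All)
open import Data.Product using (Σ; _×_)
open import Data.Sum using (_⊎_)
open import Data.Unit using (⊤)
open import Data.Empty using (⊥)
open import Relation.Nullary using (¬_)
open import Relation.Binary.PropositionalEquality using (_≡_; _≢_)

data HS : Set where
  p    : HS
  ¬'_  : HS → HS
  _∧'_ : HS → HS → HS
  ⟨B⟩  : HS → HS
  ⟨E⟩  : HS → HS
  ⟨B̄⟩  : HS → HS
  ⟨Ē⟩  : HS → HS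

size : HS → ℕ
size p        = 1
size (¬' ψ)   = suc (size ψ)
size (ψ ∧' φ) = suc (size ψ + size φ)
size (⟨B⟩ ψ)  = suc (size ψ)
size (⟨E⟩ ψ)  = suc (size ψ)
size (⟨B̄⟩ ψ)  = suc (size ψ)
size (⟨Ē⟩ ψ)  = suc (size ψ)

BalancedConj : HS → Set
BalancedConj (θ₁ ∧' θ₂) = size θ₁ ≡ size θ₂
BalancedConj _          = ⊥

Balanced : HS → Set
Balanced p        = ⊤
Balanced (¬' ψ)   = Balanced ψ
Balanced (ψ ∧' φ) = Balanced ψ × Balanced φ
Balanced (⟨B⟩ ψ)  = BalancedConj ψ × Balanced ψ
Balanced (⟨E⟩ ψ)  = Balanced ψ
Balanced (⟨B̄⟩ ψ)  = BalancedConj ψ × Balanced ψ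
Balanced (⟨Ē⟩ ψ)  = Balanced ψ

record Kripke : Set₁ where
  field
    State : Set
    δ     : State → State → Set
    μp    : State → Set        -- p ∈ μ(s)
    init  : State

module _ (K : Kripke) where
  open Kripke K

  data IsTrace : List State → Set where
    single : ∀ s → IsTrace (s ∷ [])
    step   : ∀ {s s' ρ} → δ s s' → IsTrace (s' ∷ ρ) → IsTrace (s ∷ s' ∷ ρ)

  _⊨_ : List State → HS → Set
  ρ ⊨ p        = All μp ρ
  ρ ⊨ (¬' ψ)   = ¬ (ρ ⊨ ψ)
  ρ ⊨ (ψ ∧' φ) = (ρ ⊨ ψ) × (ρ ⊨ φ)
  ρ ⊨ (⟨B⟩ ψ)  = Σ (List State) λ σ → Σ (List State) λ τ →
                   σ ≢ [] × τ ≢ [] × ρ ≡ σ ++ τ × (σ ⊨ ψ)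
  ρ ⊨ (⟨E⟩ ψ)  = Σ (List State) λ σ → Σ (List State) λ τ →
                   σ ≢ [] × τ ≢ [] × ρ ≡ σ ++ τ × (τ ⊨ ψ)
  ρ ⊨ (⟨B̄⟩ ψ)  = Σ (List State) λ τ →
                   τ ≢ [] × IsTrace (ρ ++ τ) × ((ρ ++ τ) ⊨ ψ)
  ρ ⊨ (⟨Ē⟩ ψ)  = Σ (List State) λ σ →
                   σ ≢ [] × IsTrace (σ ++ ρ) × ((σ ++ ρ) ⊨ ψ)

  IsInitial : List State → Set
  IsInitial ρ = Σ (List State) λ rest → ρ ≡ init ∷ rest

  _⊨st_ : HS → Set
  _⊨st_ ψ = ∀ ρ → IsTrace ρ → IsInitial ρ → ρ ⊨ ψ

-- The structures K_n and M_n.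
-- States: Fin (2n+2); index i (i ≤ 2n) is s_i, index 2n+1 is t.

Sₙ : ℕ → Set
Sₙ n = Fin (suc (suc (2 * n)))

δₙ : (n : ℕ) → Sₙ n → Sₙ n → Set
δₙ n a b = (toℕ a ≡ 0 × toℕ b ≡ 0)
         ⊎ (suc (toℕ a) ≡ toℕ b)                             -- (s_i,s_{i+1}), (s_{2n},t)
         ⊎ (toℕ a ≡ suc (2 * n) × toℕ b ≡ suc (2 * n))

μₙ : (n : ℕ) → Sₙ n → Set
μₙ n a = toℕ a ≡ suc (2 * n)

K : ℕ → Kripke
K n = record { State = Sₙ n ; δ = δₙ n ; μp = μₙ n ; init = fzero }

M : ℕ → Kripke
M n = record { State = Sₙ n ; δ = δₙ n ; μp = μₙ n ; init = fsuc fzero }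

module Submission where

-- A trace of K_n or M_n is a run of unlabelled states s_{y-l+1} … s_y (indices
-- below 0 read as s₀, which loops) followed by b copies of t, so it is coded by
-- (l, y, b). Call two codes m-equivalent when their run lengths agree or are
-- both ≥ m, likewise their numbers of t's, and their tops y agree or both lie at
-- least m steps before t. By an Ehrenfeucht–Fraïssé argument, no balanced
-- formula of size ≤ m separates m-equivalent traces: a suffix (⟨E⟩) costs one
-- unit; a left extension (⟨Ē⟩) costs nothing, as it only lengthens a block and
-- lengthenings can always be matched; a prefix or right extension (⟨B⟩, ⟨B̄⟩)
-- against θ₁ ∧ θ₂ with |θ₁| = |θ₂| = h needs both the cut and the rest matched
-- up to h, which a threshold above 2h allows. Finally every initial trace of
-- M_n (from s₁) is n-equivalent to an initial trace of K_n (from s₀), and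
-- conversely.

open import Defs
open import Data.Nat using (ℕ; zero; suc; _+_; _*_; _∸_; _⊓_; _≤_; _<_; z≤n; s≤s; pred)
open import Data.Nat.Properties
open import Data.Fin using (Fin; toℕ) renaming (zero to fzero; suc to fsuc)
open import Data.Fin.Properties using (toℕ-injective; toℕ<n)
open import Data.List using (List; []; _∷_; _++_; length; replicate)
open import Data.List.Properties using (∷-injective; length-++; length-replicate; ++-assoc; ++-identityʳ)
open import Data.List.Relation.Unary.All using (_∷_)
open import Data.List.Relation.Unary.All.Properties using (replicate⁺)
open import Data.Product using (Σ; _×_; _,_; proj₁; proj₂)
open import Data.Sum using (_⊎_; inj₁; inj₂)
open import Data.Empty using (⊥-elim)
open import Relation.Nullary using (¬_; yes; no)
open import Relation.Binary.PropositionalEquality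
open import Function.Bundles using (_⇔_; mk⇔)

infix 4 _≈[_]_

_≈[_]_ : ℕ → ℕ → ℕ → Set
x ≈[ m ] x' = x ≡ x' ⊎ (m ≤ x × m ≤ x')

≈-sym : ∀ {m x x'} → x ≈[ m ] x' → x' ≈[ m ] x
≈-sym (inj₁ x≡x')         = inj₁ (sym x≡x')
≈-sym (inj₂ (m≤x , m≤x')) = inj₂ (m≤x' , m≤x)

≈-weaken : ∀ {h m x x'} → h ≤ m → x ≈[ m ] x' → x ≈[ h ] x'
≈-weaken h≤m (inj₁ x≡x')         = inj₁ x≡x'
≈-weaken h≤m (inj₂ (m≤x , m≤x')) = inj₂ (≤-trans h≤m m≤x , ≤-trans h≤m m≤x')

≈-zero : ∀ {m x'} → 1 ≤ m → 0 ≈[ m ] x' → x' ≡ 0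
≈-zero _   (inj₁ 0≡x')   = sym 0≡x'
≈-zero 1≤m (inj₂ (m≤0 , _)) with ≤-trans 1≤m m≤0
... | ()

≈-pos : ∀ {m x x'} → 1 ≤ m → x ≈[ m ] x' → 1 ≤ x → 1 ≤ x'
≈-pos _   (inj₁ refl)       1≤x = 1≤x
≈-pos 1≤m (inj₂ (_ , m≤x')) _   = ≤-trans 1≤m m≤x'

+-resp-≈ : ∀ {m x x'} e → x ≈[ m ] x' → x + e ≈[ m ] x' + e
+-resp-≈ e (inj₁ refl)               = inj₁ refl
+-resp-≈ {x = x} {x'} e (inj₂ (m≤x , m≤x')) =
  inj₂ (≤-trans m≤x (m≤m+n x e) , ≤-trans m≤x' (m≤m+n x' e))

≈-move-< : ∀ {h m x x' z} → suc h ≤ m → x ≈[ m ] x' → z < x →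
           Σ ℕ λ z' → z' < x' × z ≈[ h ] z'
≈-move-< {z = z} _ (inj₁ refl) z<x = z , z<x , inj₁ refl
≈-move-< {x' = x'} {z} 1+h≤m (inj₂ (_ , m≤x')) _ with z <? x'
... | yes z<x' = z , z<x' , inj₁ refl
... | no  z≮x' = answer (≤-trans 1+h≤m m≤x') (≮⇒≥ z≮x')
  where
  answer : ∀ {h x' z} → suc h ≤ x' → x' ≤ z → Σ ℕ λ z' → z' < x' × z ≈[ h ] z'
  answer {x' = suc w} (s≤s h≤w) 1+w≤z = w , ≤-refl , inj₂ (≤-trans (n≤1+n _) (≤-trans (s≤s h≤w) 1+w≤z) , h≤w)

≈-move-≤ : ∀ {m x x' z} → x ≈[ m ] x' → z ≤ x → Σ ℕ λ z' → z' ≤ x' × z ≈[ m ] z'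
≈-move-≤ {z = z} (inj₁ refl) z≤x = z , z≤x , inj₁ refl
≈-move-≤ {x' = x'} {z} (inj₂ (_ , m≤x')) _ with z ≤? x'
... | yes z≤x' = z , z≤x' , inj₁ refl
... | no  z≰x' = x' , ≤-refl , inj₂ (≤-trans m≤x' (<⇒≤ (≰⇒> z≰x')) , m≤x')

≈-move-> : ∀ {m x x' z} → x ≈[ m ] x' → x < z → Σ ℕ λ z' → x' < z' × z ≈[ m ] z'
≈-move-> {z = z} (inj₁ refl) x<z = z , x<z , inj₁ refl
≈-move-> {x' = x'} (inj₂ (m≤x , m≤x')) x<z =
  suc x' , ≤-refl , inj₂ (≤-trans m≤x (<⇒≤ x<z) , ≤-trans m≤x' (n≤1+n x'))

≈-move-≥ : ∀ {m x x' z} → x ≈[ m ] x' → x ≤ z → Σ ℕ λ z' → x' ≤ z' × z ≈[ m ] z'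
≈-move-≥ {z = z} (inj₁ refl) x≤z = z , x≤z , inj₁ refl
≈-move-≥ {x' = x'} (inj₂ (m≤x , m≤x')) x≤z = x' , ≤-refl , inj₂ (≤-trans m≤x x≤z , m≤x')

+-pos-≈ : ∀ {m a a' c c'} → 1 ≤ m → a ≈[ m ] a' → c ≈[ m ] c' → 1 ≤ a + c → 1 ≤ a' + c'
+-pos-≈ {a = zero} 1≤m a≈ c≈ 1≤c rewrite ≈-zero 1≤m a≈ = ≈-pos 1≤m c≈ 1≤c
+-pos-≈ {a = suc _} {a'} {c' = c'} 1≤m a≈ _ _ = ≤-trans (≈-pos 1≤m a≈ (s≤s z≤n)) (m≤m+n a' c')

⊓-≈ : ∀ x m → x ⊓ m ≈[ m ] x
⊓-≈ x m with x ≤? m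
... | yes x≤m = inj₁ (m≤n⇒m⊓n≡m x≤m)
... | no  x≰m = inj₂ (≤-reflexive (sym (m≥n⇒m⊓n≡n (<⇒≤ (≰⇒> x≰m)))) , <⇒≤ (≰⇒> x≰m))

m+m<n⇒m<n : ∀ {m n} → m + m < n → m < n
m+m<n⇒m<n {m} = ≤-<-trans (m≤m+n m m)

data TailCut (b : ℕ) : ℕ → Set where
  inTail   : ∀ {k} → k ≤ b → TailCut b k
  pastTail : ∀ j → 1 ≤ j → TailCut b (j + b)

tailCut : ∀ b k → TailCut b k
tailCut b k with k ≤? b
... | yes k≤b = inTail k≤b
... | no  k≰b = subst (TailCut b) (m∸n+n≡m (<⇒≤ b<k)) (pastTail (k ∸ b) (m<n⇒0<n∸m b<k))
  where b<k = ≰⇒> k≰b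

clamp : ∀ m → ℕ → Fin (suc m)
clamp _       zero    = fzero
clamp zero    (suc _) = fzero
clamp (suc m) (suc i) = fsuc (clamp m i)

toℕ-clamp : ∀ {m i} → i ≤ m → toℕ (clamp m i) ≡ i
toℕ-clamp {i = zero}          _         = refl
toℕ-clamp {suc m} {suc i} (s≤s i≤m) = cong suc (toℕ-clamp i≤m)

replicate-+ : ∀ {A : Set} a c (x : A) → replicate (a + c) x ≡ replicate a x ++ replicate c x
replicate-+ zero    c x = refl
replicate-+ (suc a) c x = cong (x ∷_) (replicate-+ a c x)

m∸n≡1⇒m≡1+n : ∀ m n → m ∸ n ≡ 1 → m ≡ suc n
m∸n≡1⇒m≡1+n m       zero    m≡1   = m≡1
m∸n≡1⇒m≡1+n (suc m) (suc n) m∸n≡1 = cong suc (m∸n≡1⇒m≡1+n m n m∸n≡1)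

≢[]⇒1≤length : ∀ {A : Set} {xs : List A} → xs ≢ [] → 1 ≤ length xs
≢[]⇒1≤length {xs = []}    xs≢[] = ⊥-elim (xs≢[] refl)
≢[]⇒1≤length {xs = _ ∷ _} _     = s≤s z≤n

++-cancel-lengthˡ : ∀ {A : Set} (xs xs' : List A) {ys ys'} → length xs ≡ length xs' →
                    xs ++ ys ≡ xs' ++ ys' → xs ≡ xs' × ys ≡ ys'
++-cancel-lengthˡ []       []         _  e = refl , e
++-cancel-lengthˡ (x ∷ xs) (x' ∷ xs') |xs|≡|xs'| e
  with ∷-injective e | ++-cancel-lengthˡ xs xs' (suc-injective |xs|≡|xs'|) (proj₂ (∷-injective e))
... | refl , _ | xs≡xs' , ys≡ys' = cong (x ∷_) xs≡xs' , ys≡ys'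

++-cancel-lengthʳ : ∀ {A : Set} (xs xs' : List A) {ys ys'} → length ys ≡ length ys' →
                    xs ++ ys ≡ xs' ++ ys' → xs ≡ xs' × ys ≡ ys'
++-cancel-lengthʳ xs xs' {ys} {ys'} |ys|≡|ys'| e = ++-cancel-lengthˡ xs xs' |xs|≡|xs'| e
  where
  |xs|≡|xs'| = +-cancelʳ-≡ (length ys) (length xs) (length xs')
    (trans (sym (length-++ xs))
      (trans (cong length e) (trans (length-++ xs') (cong (length xs' +_) (sym |ys|≡|ys'|)))))

module Chain (n : ℕ) where

  2n : ℕ
  2n = 2 * n

  2n+1 : ℕ
  2n+1 = suc 2n

  n≤2n : n ≤ 2n
  n≤2n = m≤m+n n (n + 0)

  -- code l y b is the trace s_{y-l+1} … s_y t^b, where indices below 0 stand for s₀.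
  record Code : Set where
    constructor code
    field
      run top tail : ℕ
  open Code

  len : Code → ℕ
  len c = run c + tail c

  Valid : Code → Set
  Valid (code l y b) = y ≤ 2n × (1 ≤ b → y ≡ 2n) × 1 ≤ l + b

  ProperCut : Code → ℕ → Set
  ProperCut c k = 1 ≤ k × k < len c

  infix 4 _≈ᵗ[_]_ _≈ᶜ[_]_

  _≈ᵗ[_]_ : ℕ → ℕ → ℕ → Set
  y ≈ᵗ[ m ] y' = y ≡ y' ⊎ (y + m ≤ 2n+1 × y' + m ≤ 2n+1)

  _≈ᶜ[_]_ : Code → ℕ → Code → Set
  code l y b ≈ᶜ[ m ] code l' y' b' = l ≈[ m ] l' × b ≈[ m ] b' × y ≈ᵗ[ m ] y'

  takeLast : Code → ℕ → Code
  takeLast (code l y b) k with k ≤? b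
  ... | yes _ = code 0 2n k
  ... | no  _ = code (k ∸ b) y b

  dropLast : Code → ℕ → Code
  dropLast (code l y b) k with k ≤? b
  ... | yes _ = code l y (b ∸ k)
  ... | no  _ = code (l ∸ (k ∸ b)) (y ∸ (k ∸ b)) 0

  takeLast-inTail : ∀ {l y b k} → k ≤ b → takeLast (code l y b) k ≡ code 0 2n k
  takeLast-inTail {b = b} {k} k≤b with k ≤? b
  ... | yes _   = refl
  ... | no  k≰b = ⊥-elim (k≰b k≤b)

  takeLast-pastTail : ∀ {l y b} j → 1 ≤ j → takeLast (code l y b) (j + b) ≡ code j y b
  takeLast-pastTail {b = b} j 1≤j with j + b ≤? b
  ... | yes j+b≤b = ⊥-elim (<⇒≱ (m<n+m b 1≤j) j+b≤b)
  ... | no  _     = cong (λ r → code r _ b) (m+n∸n≡m j b)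

  dropLast-inTail : ∀ {l y b k} → k ≤ b → dropLast (code l y b) k ≡ code l y (b ∸ k)
  dropLast-inTail {b = b} {k} k≤b with k ≤? b
  ... | yes _   = refl
  ... | no  k≰b = ⊥-elim (k≰b k≤b)

  dropLast-pastTail : ∀ {l y b} j → 1 ≤ j → dropLast (code l y b) (j + b) ≡ code (l ∸ j) (y ∸ j) 0
  dropLast-pastTail {l} {y} {b} j 1≤j with j + b ≤? b
  ... | yes j+b≤b = ⊥-elim (<⇒≱ (m<n+m b 1≤j) j+b≤b)
  ... | no  _     = cong (λ i → code (l ∸ i) (y ∸ i) 0) (m+n∸n≡m j b)

  ≈ᵗ-sym : ∀ {m y y'} → y ≈ᵗ[ m ] y' → y' ≈ᵗ[ m ] y
  ≈ᵗ-sym (inj₁ y≡y')       = inj₁ (sym y≡y')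
  ≈ᵗ-sym (inj₂ (far , far')) = inj₂ (far' , far)

  ∸-resp-≈ᵗ : ∀ {h m y y'} j → h ≤ m → y ≈ᵗ[ m ] y' → y ∸ j ≈ᵗ[ h ] y' ∸ j
  ∸-resp-≈ᵗ j _ (inj₁ refl) = inj₁ refl
  ∸-resp-≈ᵗ {y = y} {y'} j h≤m (inj₂ (far , far')) =
    inj₂ (≤-trans (+-mono-≤ (m∸n≤m y j) h≤m) far , ≤-trans (+-mono-≤ (m∸n≤m y' j) h≤m) far')

  ≈ᵗ-weaken : ∀ {h m y y'} → h ≤ m → y ≈ᵗ[ m ] y' → y ≈ᵗ[ h ] y'
  ≈ᵗ-weaken = ∸-resp-≈ᵗ 0

  ≈ᶜ-sym : ∀ {m c c'} → c ≈ᶜ[ m ] c' → c' ≈ᶜ[ m ] c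
  ≈ᶜ-sym {c = code _ _ _} {code _ _ _} (l≈ , b≈ , y≈) = ≈-sym l≈ , ≈-sym b≈ , ≈ᵗ-sym y≈

  ≈ᶜ-weaken : ∀ {h m c c'} → h ≤ m → c ≈ᶜ[ m ] c' → c ≈ᶜ[ h ] c'
  ≈ᶜ-weaken {c = code _ _ _} {code _ _ _} h≤m (l≈ , b≈ , y≈) =
    ≈-weaken h≤m l≈ , ≈-weaken h≤m b≈ , ≈ᵗ-weaken h≤m y≈

  ≈ᶜ-subst : ∀ {m c₁ c₂ c₁' c₂'} → c₁ ≡ c₂ → c₁' ≡ c₂' → c₂ ≈ᶜ[ m ] c₂' → c₁ ≈ᶜ[ m ] c₁'
  ≈ᶜ-subst refl refl r = r

  move-inTail : ∀ {h m l l' b b' k} → suc h ≤ m → l ≈[ m ] l' → b ≈[ m ] b' →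
                k ≤ b → k < l + b → Σ ℕ λ k' → k' ≤ b' × k' < l' + b' × k ≈[ h ] k'
  move-inTail {l = zero} 1+h≤m l≈ b≈ _ k<b
    with ≈-zero (≤-trans (s≤s z≤n) 1+h≤m) l≈ | ≈-move-< 1+h≤m b≈ k<b
  ... | refl | k' , k'<b' , k≈k' = k' , <⇒≤ k'<b' , k'<b' , k≈k'
  move-inTail {h} {l = suc _} {l'} {b' = b'} 1+h≤m l≈ b≈ k≤b _ with ≈-move-≤ b≈ k≤b
  ... | k' , k'≤b' , k≈k' =
    k' , k'≤b' , ≤-trans (s≤s k'≤b') (+-monoˡ-≤ b' 1≤l') , ≈-weaken (≤-trans (n≤1+n h) 1+h≤m) k≈k'
    where
    1≤l' : 1 ≤ l'
    1≤l' = ≈-pos (≤-trans (s≤s z≤n) 1+h≤m) l≈ (s≤s z≤n)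

  takeLast-move : ∀ {h m} c c' → 1 ≤ h → suc h ≤ m → c ≈ᶜ[ m ] c' → ∀ {k} → ProperCut c k →
                  Σ ℕ λ k' → ProperCut c' k' × takeLast c k ≈ᶜ[ h ] takeLast c' k'
  takeLast-move (code l y b) (code l' y' b') 1≤h 1+h≤m (l≈ , b≈ , y≈) {k} (1≤k , k<len)
    with tailCut b k
  ... | inTail k≤b with move-inTail 1+h≤m l≈ b≈ k≤b k<len
  ...   | k' , k'≤b' , k'<len' , k≈k' =
    k' , (≈-pos 1≤h k≈k' 1≤k , k'<len') ,
    ≈ᶜ-subst (takeLast-inTail {l} {y} k≤b) (takeLast-inTail {l'} {y'} k'≤b') (inj₁ refl , k≈k' , inj₁ refl)
  takeLast-move (code l y b) (code l' y' b') 1≤h 1+h≤m (l≈ , b≈ , y≈) (_ , k<len) | pastTail j 1≤j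
    with ≈-move-< 1+h≤m l≈ (+-cancelʳ-< b j l k<len)
  ... | j' , j'<l' , j≈j' =
    j' + b' , (≤-trans 1≤j' (m≤m+n j' b') , +-monoˡ-< b' j'<l') ,
    ≈ᶜ-subst (takeLast-pastTail {l} j 1≤j) (takeLast-pastTail {l'} j' 1≤j')
      (j≈j' , ≈-weaken h≤m b≈ , ≈ᵗ-weaken h≤m y≈)
    where
    h≤m = ≤-trans (n≤1+n _) 1+h≤m
    1≤j' = ≈-pos 1≤h j≈j' 1≤j

  ∸-far : ∀ {h j y} → h ≤ 2n+1 → h ≤ j → y ≤ 2n → y ∸ j + h ≤ 2n+1
  ∸-far {h} {j} {y} h≤2n+1 h≤j y≤2n with y ≤? j
  ... | yes y≤j rewrite m≤n⇒m∸n≡0 y≤j = h≤2n+1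
  ... | no  y≰j = begin
    y ∸ j + h  ≤⟨ +-monoʳ-≤ (y ∸ j) h≤j ⟩
    y ∸ j + j  ≡⟨ m∸n+n≡m (<⇒≤ (≰⇒> y≰j)) ⟩
    y          ≤⟨ m≤n⇒m≤1+n y≤2n ⟩
    2n+1       ∎
    where open ≤-Reasoning

  short-rest⇒long-cut : ∀ {h l j} → h + h ≤ l → l ∸ j < h → h ≤ j
  short-rest⇒long-cut {h} {l} {j} 2h≤l l∸j<h = <⇒≤ (+-cancelʳ-< h h j (begin-strict
    h + h          ≤⟨ 2h≤l ⟩
    l              ≤⟨ m≤n+m∸n l j ⟩
    j + (l ∸ j)    <⟨ +-monoʳ-< j l∸j<h ⟩
    j + h          ∎))
    where open ≤-Reasoning

  -- The rest l ∸ j is copied exactly when shorter than h and kept ≥ h otherwise;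
  -- unless the cut j itself can be copied, both cuts are then ≥ h, which puts
  -- both new tops at least h before t.
  move-inLongRun : ∀ {h m l l' y y' j} → 1 ≤ h → h + h < m → h ≤ 2n+1 →
                   m ≤ l → m ≤ l' → y ≈ᵗ[ m ] y' → y ≤ 2n → y' ≤ 2n → 1 ≤ j → j < l →
                   Σ ℕ λ j' → 1 ≤ j' × j' < l' × l ∸ j ≈[ h ] l' ∸ j' × y ∸ j ≈ᵗ[ h ] y' ∸ j'
  move-inLongRun {h} {l = l} {l'} {j = j} 1≤h 2h<m h≤2n+1 m≤l m≤l' y≈ y≤2n y'≤2n 1≤j j<l
    with l ∸ j <? h
  ... | yes i<h =
    l' ∸ i , m<n⇒0<n∸m i<l' , ∸-monoʳ-< (m<n⇒0<n∸m j<l) (<⇒≤ i<l') ,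
    inj₁ (sym (m∸[m∸n]≡n (<⇒≤ i<l'))) ,
    inj₂ (∸-far h≤2n+1 (short-rest⇒long-cut {j = j} 2h≤l i<h) y≤2n ,
          ∸-far h≤2n+1 (m+n≤o⇒m≤o∸n h (≤-trans (+-monoʳ-≤ h (<⇒≤ i<h)) 2h≤l')) y'≤2n)
    where
    i = l ∸ j
    2h≤l  = ≤-trans (<⇒≤ 2h<m) m≤l
    2h≤l' = ≤-trans (<⇒≤ 2h<m) m≤l'
    i<l' : i < l'
    i<l' = <-≤-trans i<h (≤-trans (m≤m+n h h) 2h≤l')
  ... | no i≮h with h + j ≤? l'
  ...   | yes h+j≤l' =
    j , 1≤j , <-≤-trans (m<n+m j 1≤h) h+j≤l' ,
    inj₂ (≮⇒≥ i≮h , m+n≤o⇒m≤o∸n h h+j≤l') , ∸-resp-≈ᵗ j (<⇒≤ (m+m<n⇒m<n 2h<m)) y≈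
  ...   | no h+j≰l' =
    l' ∸ h , m<n⇒0<n∸m h<l' , ∸-monoʳ-< 1≤h (<⇒≤ h<l') ,
    inj₂ (≮⇒≥ i≮h , ≤-reflexive (sym (m∸[m∸n]≡n (<⇒≤ h<l')))) ,
    inj₂ (∸-far h≤2n+1 h≤j y≤2n , ∸-far h≤2n+1 h≤l'∸h y'≤2n)
    where
    2h≤l' = ≤-trans (<⇒≤ 2h<m) m≤l'
    h<l' : h < l'
    h<l' = <-≤-trans (m<m+n h 1≤h) 2h≤l'
    h≤j : h ≤ j
    h≤j = <⇒≤ (+-cancelˡ-< h h j (≤-<-trans 2h≤l' (≰⇒> h+j≰l')))
    h≤l'∸h : h ≤ l' ∸ h
    h≤l'∸h = m+n≤o⇒m≤o∸n h 2h≤l'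

  move-inRun : ∀ {h m l l' y y' j} → 1 ≤ h → h + h < m → h ≤ 2n+1 →
               l ≈[ m ] l' → y ≈ᵗ[ m ] y' → y ≤ 2n → y' ≤ 2n → 1 ≤ j → j < l →
               Σ ℕ λ j' → 1 ≤ j' × j' < l' × l ∸ j ≈[ h ] l' ∸ j' × y ∸ j ≈ᵗ[ h ] y' ∸ j'
  move-inRun {j = j} _ 2h<m _ (inj₁ refl) y≈ _ _ 1≤j j<l =
    j , 1≤j , j<l , inj₁ refl , ∸-resp-≈ᵗ j (<⇒≤ (m+m<n⇒m<n 2h<m)) y≈
  move-inRun 1≤h 2h<m h≤2n+1 (inj₂ (m≤l , m≤l')) =
    move-inLongRun 1≤h 2h<m h≤2n+1 m≤l m≤l'

  dropLast-move : ∀ {h m} c c' → 1 ≤ h → h + h < m → h ≤ 2n+1 → Valid c → Valid c' →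
                  c ≈ᶜ[ m ] c' → ∀ {k} → ProperCut c k →
                  Σ ℕ λ k' → ProperCut c' k' × dropLast c k ≈ᶜ[ h ] dropLast c' k'
  dropLast-move (code l y b) (code l' y' b') 1≤h 2h<m _ _ _ (l≈ , b≈ , y≈) {k} (1≤k , k<len)
    with tailCut b k
  ... | inTail k≤b with ≈-move-< (m+m<n⇒m<n 2h<m) b≈ (∸-monoʳ-< 1≤k k≤b)
  ...   | r' , r'<b' , r≈r' =
    b' ∸ r' , (m<n⇒0<n∸m r'<b' , b'∸r'<len') ,
    ≈ᶜ-subst (dropLast-inTail {l} {y} k≤b) (dropLast-inTail {l'} {y'} (m∸n≤m b' r'))
      (≈-weaken h≤m l≈ , subst (b ∸ k ≈[ _ ]_) (sym (m∸[m∸n]≡n (<⇒≤ r'<b'))) r≈r' , ≈ᵗ-weaken h≤m y≈)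
    where
    h≤m = <⇒≤ (m+m<n⇒m<n 2h<m)
    1≤l'+r' : 1 ≤ l' + r'
    1≤l'+r' = +-pos-≈ 1≤h (≈-weaken h≤m l≈) r≈r'
                (subst (1 ≤_) (+-∸-assoc l k≤b) (m<n⇒0<n∸m k<len))
    b'∸r'<len' : b' ∸ r' < l' + b'
    b'∸r'<len' = begin-strict
      b' ∸ r'               <⟨ m<n+m (b' ∸ r') 1≤l'+r' ⟩
      l' + r' + (b' ∸ r')   ≡⟨ +-assoc l' r' (b' ∸ r') ⟩
      l' + (r' + (b' ∸ r')) ≡⟨ cong (l' +_) (m+[n∸m]≡n (<⇒≤ r'<b')) ⟩
      l' + b'               ∎
      where open ≤-Reasoning
  dropLast-move (code l y b) (code l' y' b') 1≤h 2h<m h≤2n+1 (y≤2n , _) (y'≤2n , _) (l≈ , b≈ , y≈)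
    (_ , k<len) | pastTail j 1≤j
    with move-inRun 1≤h 2h<m h≤2n+1 l≈ y≈ y≤2n y'≤2n 1≤j (+-cancelʳ-< b j l k<len)
  ... | j' , 1≤j' , j'<l' , l∸j≈ , y∸j≈ =
    j' + b' , (≤-trans 1≤j' (m≤m+n j' b') , +-monoˡ-< b' j'<l') ,
    ≈ᶜ-subst (dropLast-pastTail {l} {y} j 1≤j) (dropLast-pastTail {l'} {y'} j' 1≤j')
      (l∸j≈ , inj₁ refl , y∸j≈)

  ∸+≤⇒≤ : ∀ {y j h} → y ∸ j + h ≤ y → h ≤ j
  ∸+≤⇒≤ {y} {j} {h} le with y ≤? j
  ... | yes y≤j = ≤-trans (≤-trans (m≤n+m h (y ∸ j)) le) y≤j
  ... | no  y≰j = +-cancelˡ-≤ (y ∸ j) h j (≤-trans le (≤-reflexive (sym (m∸n+n≡m (<⇒≤ (≰⇒> y≰j))))))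

  Regrowth : ℕ → Code → ℕ → ℕ → Set
  Regrowth h c⁺ l' y' = Σ ℕ λ j' → Σ ℕ λ y⁺' → 1 ≤ j' × y⁺' ∸ j' ≡ y' ×
    Valid (code (l' + j') y⁺' (tail c⁺)) × c⁺ ≈ᶜ[ h ] code (l' + j') y⁺' (tail c⁺)

  regrow-by : ∀ {h m l⁺ y⁺ b⁺ l' y' j} y⁺' → h ≤ m → 1 ≤ j → j < l⁺ → l⁺ ∸ j ≈[ m ] l' →
              y⁺' ∸ j ≡ y' → y⁺' ≤ 2n → (1 ≤ b⁺ → y⁺' ≡ 2n) → y⁺ ≈ᵗ[ h ] y⁺' →
              Regrowth h (code l⁺ y⁺ b⁺) l' y'
  regrow-by {l' = l'} {j = j} y⁺' h≤m 1≤j j<l⁺ l⁺∸j≈l' y⁺'∸j≡y' y⁺'≤2n tail→2n y⁺≈ =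
    j , y⁺' , 1≤j , y⁺'∸j≡y' ,
    (y⁺'≤2n , tail→2n , ≤-trans 1≤j (≤-trans (m≤n+m j l') (m≤m+n _ _))) ,
    (subst (_≈[ _ ] l' + j) (m∸n+n≡m (<⇒≤ j<l⁺)) (+-resp-≈ j (≈-weaken h≤m l⁺∸j≈l')) , inj₁ refl , y⁺≈)

  regrow-to : ∀ {h l⁺ y⁺ b⁺ l' y' j} z → 1 ≤ h → h ≤ j → j < l⁺ → z ≤ 2n → y' + h ≤ z →
              (1 ≤ b⁺ → z ≡ 2n) → y⁺ ≈ᵗ[ h ] z → Regrowth h (code l⁺ y⁺ b⁺) l' y'
  regrow-to {h} {l' = l'} {y'} z 1≤h h≤j j<l⁺ z≤2n y'+h≤z tail→2n y⁺≈z =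
    z ∸ y' , z , ≤-trans 1≤h h≤z∸y' , m∸[m∸n]≡n (≤-trans (m≤m+n y' h) y'+h≤z) ,
    (z≤2n , tail→2n , ≤-trans (≤-trans 1≤h h≤z∸y') (≤-trans (m≤n+m _ l') (m≤m+n _ _))) ,
    (inj₂ (≤-trans h≤j (<⇒≤ j<l⁺) , ≤-trans h≤z∸y' (m≤n+m _ l')) , inj₁ refl , y⁺≈z)
    where
    h≤z∸y' : h ≤ z ∸ y'
    h≤z∸y' = m+n≤o⇒m≤o∸n h (≤-trans (≤-reflexive (+-comm h y')) y'+h≤z)

  far-strict : ∀ {h m y} → h < m → y + m ≤ 2n+1 → y + h ≤ 2n
  far-strict {h} {m} {y} h<m far = ≤-pred (begin
    suc (y + h)  ≡⟨ +-suc y h ⟨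
    y + suc h    ≤⟨ +-monoʳ-≤ y h<m ⟩
    y + m        ≤⟨ far ⟩
    2n+1         ∎)
    where open ≤-Reasoning

  far-below-near : ∀ {h m y z} → h + h ≤ m → y + m ≤ 2n+1 → 2n+1 < z + h → y + h ≤ z
  far-below-near {h} {m} {y} {z} 2h≤m far near = <⇒≤ (+-cancelʳ-< h (y + h) z (begin-strict
    y + h + h    ≡⟨ +-assoc y h h ⟩
    y + (h + h)  ≤⟨ +-monoʳ-≤ y 2h≤m ⟩
    y + m        ≤⟨ far ⟩
    2n+1         <⟨ near ⟩
    z + h        ∎))
    where open ≤-Reasoning

  -- When y⁺ ∸ j = y' the top y⁺ is kept. Otherwise both are far from t, and the new
  -- top is y⁺ if that is near t (always so when c⁺ has a tail), y' + j if that is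
  -- still far, and else the index exactly h before t.
  regrow : ∀ {h m l⁺ y⁺ b⁺ l' y' j} → 1 ≤ h → h + h < m → h ≤ 2n+1 → Valid (code l⁺ y⁺ b⁺) →
           1 ≤ j → j < l⁺ → l⁺ ∸ j ≈[ m ] l' → y⁺ ∸ j ≈ᵗ[ m ] y' → Regrowth h (code l⁺ y⁺ b⁺) l' y'
  regrow {y⁺ = y⁺} _ 2h<m _ (y⁺≤2n , tail→2n , _) 1≤j j<l⁺ l≈ (inj₁ y⁺∸j≡y') =
    regrow-by y⁺ (<⇒≤ (m+m<n⇒m<n 2h<m)) 1≤j j<l⁺ l≈ y⁺∸j≡y' y⁺≤2n tail→2n (inj₁ refl)
  regrow {b⁺ = suc _} 1≤h 2h<m _ (_ , tail→2n , _) _ j<l⁺ _ (inj₂ (far , far'))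
    with tail→2n (s≤s z≤n)
  ... | refl =
    regrow-to 2n 1≤h (∸+≤⇒≤ (far-strict h<m far)) j<l⁺ ≤-refl (far-strict h<m far') tail→2n (inj₁ refl)
    where
    h<m = m+m<n⇒m<n 2h<m
  regrow {h} {y⁺ = y⁺} {zero} {y' = y'} {j} 1≤h 2h<m h≤2n+1 (y⁺≤2n , _ , _) 1≤j j<l⁺ l≈
    (inj₂ (far , far'))
    with y⁺ + h ≤? 2n+1
  ... | no near =
    regrow-to y⁺ 1≤h (∸+≤⇒≤ {y⁺} (far-below-near 2h≤m far (≰⇒> near))) j<l⁺ y⁺≤2n
      (far-below-near 2h≤m far' (≰⇒> near)) (λ ()) (inj₁ refl)
    where
    2h≤m = <⇒≤ 2h<m
  ... | yes y⁺-far with y' + j + h ≤? 2n+1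
  ...   | yes fits =
    regrow-by (y' + j) (<⇒≤ (m+m<n⇒m<n 2h<m)) 1≤j j<l⁺ l≈ (m+n∸n≡m y' j)
      (≤-pred (≤-trans (m<m+n (y' + j) 1≤h) fits))
      (λ ()) (inj₂ (y⁺-far , fits))
  ...   | no ¬fits =
    regrow-to (2n+1 ∸ h) 1≤h h≤j j<l⁺ (∸-monoʳ-≤ 2n+1 1≤h) (m+n≤o⇒m≤o∸n (y' + h) y'+2h≤2n+1) (λ ())
      (inj₂ (y⁺-far , ≤-reflexive (m∸n+n≡m h≤2n+1)))
    where
    y'+2h≤2n+1 : y' + h + h ≤ 2n+1
    y'+2h≤2n+1 = ≤-trans (≤-reflexive (+-assoc y' h h)) (≤-trans (+-monoʳ-≤ y' (<⇒≤ 2h<m)) far')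
    h≤j : h ≤ j
    h≤j = <⇒≤ (+-cancelˡ-< y' h j (+-cancelʳ-< h (y' + h) (y' + j) (≤-<-trans y'+2h≤2n+1 (≰⇒> ¬fits))))

  ≈ᵗ-2n : ∀ {m y'} → 2 ≤ m → 2n ≈ᵗ[ m ] y' → y' ≡ 2n
  ≈ᵗ-2n _   (inj₁ 2n≡y')       = sym 2n≡y'
  ≈ᵗ-2n 2≤m (inj₂ (2n+m≤2n+1 , _)) =
    ⊥-elim (<⇒≱ 2≤m (+-cancelˡ-≤ 2n _ 1 (≤-trans 2n+m≤2n+1 (≤-reflexive (sym (+-comm 2n 1))))))

  ExtendsRight : Code → Code → Set
  ExtendsRight c⁺ c = Σ ℕ λ k → ProperCut c⁺ k × dropLast c⁺ k ≡ c

  extendRight-move : ∀ {h m c c'} c⁺ → 1 ≤ h → h + h < m → h ≤ 2n+1 → Valid c' → Valid c⁺ →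
                     c ≈ᶜ[ m ] c' → ExtendsRight c⁺ c →
                     Σ Code λ c⁺' → Valid c⁺' × ExtendsRight c⁺' c' × c⁺ ≈ᶜ[ h ] c⁺'
  extendRight-move {h} {m} {c' = code l' y' b'} (code l⁺ y⁺ b⁺) 1≤h 2h<m _
    (y'≤2n , _ , 1≤len') (_ , tail→2n , _) r (k , (1≤k , k<len) , refl) with tailCut b⁺ k
  ... | inTail k≤b⁺ with ≈ᶜ-subst (sym (dropLast-inTail {l⁺} {y⁺} k≤b⁺)) refl r
  ...   | l≈ , b≈ , y≈ =
    code l' y' (b' + k) ,
    (y'≤2n , (λ _ → y'≡2n) , ≤-trans 1≤k (≤-trans (m≤n+m k b') (m≤n+m _ l'))) ,
    (k , (1≤k , subst (k <_) (+-assoc l' b' k) (m<n+m k 1≤len')) ,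
     trans (dropLast-inTail {l'} {y'} (m≤n+m k b')) (cong (code l' y') (m+n∸n≡m b' k))) ,
    (≈-weaken h≤m l≈ , subst (_≈[ h ] b' + k) (m∸n+n≡m k≤b⁺) (+-resp-≈ k (≈-weaken h≤m b≈)) ,
     ≈ᵗ-weaken h≤m y≈)
    where
    h≤m = <⇒≤ (m+m<n⇒m<n 2h<m)
    y'≡2n : y' ≡ 2n
    y'≡2n = ≈ᵗ-2n (≤-trans (+-mono-≤ 1≤h 1≤h) (<⇒≤ 2h<m))
                  (subst (_≈ᵗ[ m ] y') (tail→2n (≤-trans 1≤k k≤b⁺)) y≈)
  extendRight-move {c' = code l' y' b'} (code l⁺ y⁺ b⁺) 1≤h 2h<m h≤2n+1 _ valid⁺ r
    (_ , (_ , k<len) , refl) | pastTail j 1≤j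
    with ≈ᶜ-subst (sym (dropLast-pastTail {l⁺} {y⁺} j 1≤j)) refl r
  ... | l≈ , b≈ , y≈ with ≈-zero 1≤m b≈ | regrow 1≤h 2h<m h≤2n+1 valid⁺ 1≤j j<l⁺ l≈ y≈
    where
    1≤m = ≤-trans (s≤s z≤n) 2h<m
    j<l⁺ = +-cancelʳ-< b⁺ j l⁺ k<len
  ...   | refl | j' , y⁺' , 1≤j' , y⁺'∸j'≡y' , valid⁺' , r⁺ =
    code (l' + j') y⁺' b⁺ , valid⁺' ,
    (j' + b⁺ , (≤-trans 1≤j' (m≤m+n j' b⁺) , +-monoˡ-< b⁺ (subst (j' <_) (+-comm j' l') (m<m+n j' 1≤l'))) ,
     trans (dropLast-pastTail {l' + j'} {y⁺'} j' 1≤j')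
           (cong₂ (λ l y → code l y 0) (m+n∸n≡m l' j') y⁺'∸j'≡y')) ,
    r⁺
    where
    1≤l' : 1 ≤ l'
    1≤l' = ≈-pos (≤-trans (s≤s z≤n) 2h<m) l≈ (m<n⇒0<n∸m (+-cancelʳ-< b⁺ j l⁺ k<len))

  ExtendsLeft : Code → Code → Set
  ExtendsLeft c⁺ c = Σ ℕ λ k → ProperCut c⁺ k × takeLast c⁺ k ≡ c

  move-aboveTail : ∀ {m l⁺ b⁺ k b'} → k ≈[ m ] b' → k ≤ b⁺ → k < l⁺ + b⁺ →
                   Σ ℕ λ b⁺' → b' ≤ b⁺' × b' < l⁺ + b⁺' × b⁺ ≈[ m ] b⁺'
  move-aboveTail {l⁺ = zero} k≈b' _ k<b⁺ with ≈-move-> k≈b' k<b⁺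
  ... | b⁺' , b'<b⁺' , b⁺≈ = b⁺' , <⇒≤ b'<b⁺' , b'<b⁺' , b⁺≈
  move-aboveTail {l⁺ = suc l⁺} {b' = b'} k≈b' k≤b⁺ _ with ≈-move-≥ k≈b' k≤b⁺
  ... | b⁺' , b'≤b⁺' , b⁺≈ = b⁺' , b'≤b⁺' , s≤s (≤-trans b'≤b⁺' (m≤n+m _ l⁺)) , b⁺≈

  extendLeft-move : ∀ {m c c'} c⁺ → 1 ≤ m → Valid c' → Valid c⁺ → c ≈ᶜ[ m ] c' → ExtendsLeft c⁺ c →
                    Σ Code λ c⁺' → Valid c⁺' × ExtendsLeft c⁺' c' × c⁺ ≈ᶜ[ m ] c⁺'
  extendLeft-move {c' = code l' y' b'} (code l⁺ y⁺ b⁺) 1≤m (_ , tail'→2n , 1≤len') (y⁺≤2n , tail→2n , _)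
    r (k , (1≤k , k<len) , refl) with tailCut b⁺ k
  ... | inTail k≤b⁺ with ≈ᶜ-subst (sym (takeLast-inTail {l⁺} {y⁺} k≤b⁺)) refl r
  ...   | l≈ , b≈ , y≈ with ≈-zero 1≤m l≈ | move-aboveTail b≈ k≤b⁺ k<len
  ...     | refl | b⁺' , b'≤b⁺' , b'<len⁺' , b⁺≈ =
    code l⁺ y⁺ b⁺' , (y⁺≤2n , (λ _ → tail→2n (≤-trans 1≤k k≤b⁺)) , ≤-trans (s≤s z≤n) b'<len⁺') ,
    (b' , (1≤len' , b'<len⁺') ,
     trans (takeLast-inTail {l⁺} {y⁺} b'≤b⁺') (cong (λ y → code 0 y b') (sym (tail'→2n 1≤len')))) ,
    (inj₁ refl , b⁺≈ , inj₁ refl)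
  extendLeft-move {c' = code l' y' b'} (code l⁺ y⁺ b⁺) 1≤m (y'≤2n , tail'→2n , _) _ r
    (_ , (_ , k<len) , refl) | pastTail j 1≤j
    with ≈ᶜ-subst (sym (takeLast-pastTail {l⁺} {y⁺} j 1≤j)) refl r
  ... | j≈l' , b≈ , y≈ with ≈-move-> j≈l' (+-cancelʳ-< b⁺ j l⁺ k<len)
  ...   | l⁺' , l'<l⁺' , l⁺≈ =
    code l⁺' y' b' , (y'≤2n , tail'→2n , ≤-trans (s≤s z≤n) (+-monoˡ-< b' l'<l⁺')) ,
    (l' + b' , (≤-trans 1≤l' (m≤m+n l' b') , +-monoˡ-< b' l'<l⁺') , takeLast-pastTail {l⁺'} l' 1≤l') ,
    (l⁺≈ , b≈ , y≈)
    where
    1≤l' = ≈-pos 1≤m j≈l' 1≤j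

  State : Set
  State = Sₙ n

  state : ℕ → State
  state = clamp 2n+1

  t : State
  t = state 2n+1

  toℕ-state : ∀ {i} → i ≤ 2n+1 → toℕ (state i) ≡ i
  toℕ-state = toℕ-clamp

  toℕ-state≢t : ∀ {i} → i ≤ 2n → toℕ (state i) ≢ 2n+1
  toℕ-state≢t i≤2n s≡t = <-irrefl (trans (sym (toℕ-state (m≤n⇒m≤1+n i≤2n))) s≡t) (s≤s i≤2n)

  toℕ-state-run : ∀ {y} l → y ≤ 2n → toℕ (state (y ∸ l)) ≡ y ∸ l
  toℕ-state-run {y} l y≤2n = toℕ-state (m≤n⇒m≤1+n (≤-trans (m∸n≤m y l) y≤2n))

  toℕ-t : toℕ t ≡ 2n+1
  toℕ-t = toℕ-state ≤-refl

  state-toℕ : ∀ {s i} → toℕ s ≡ i → state i ≡ s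
  state-toℕ {s} refl = toℕ-injective (toℕ-state (≤-pred (toℕ<n s)))

  sRun : ℕ → ℕ → List State
  sRun zero    y = []
  sRun (suc l) y = state (y ∸ l) ∷ sRun l y

  word : Code → List State
  word (code l y b) = sRun l y ++ replicate b t

  length-sRun : ∀ l y → length (sRun l y) ≡ l
  length-sRun zero    y = refl
  length-sRun (suc l) y = cong suc (length-sRun l y)

  length-word : ∀ c → length (word c) ≡ len c
  length-word (code l y b) = trans (length-++ (sRun l y)) (cong₂ _+_ (length-sRun l y) (length-replicate b))

  sRun-+ : ∀ a j y → sRun (a + j) y ≡ sRun a (y ∸ j) ++ sRun j y
  sRun-+ zero    j y = refl
  sRun-+ (suc a) j y = cong₂ _∷_ (cong state (trans (cong (y ∸_) (+-comm a j)) (sym (∸-+-assoc y j a))))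
                                 (sRun-+ a j y)

  word-split : ∀ c k → k ≤ len c → word c ≡ word (dropLast c k) ++ word (takeLast c k)
  word-split (code l y b) k k≤len with tailCut b k
  ... | inTail k≤b
    rewrite dropLast-inTail {l} {y} k≤b | takeLast-inTail {l} {y} k≤b = begin
      sRun l y ++ replicate b t
        ≡⟨ cong (λ b → sRun l y ++ replicate b t) (m∸n+n≡m k≤b) ⟨
      sRun l y ++ replicate (b ∸ k + k) t
        ≡⟨ cong (sRun l y ++_) (replicate-+ (b ∸ k) k t) ⟩
      sRun l y ++ (replicate (b ∸ k) t ++ replicate k t)
        ≡⟨ ++-assoc (sRun l y) _ _ ⟨
      (sRun l y ++ replicate (b ∸ k) t) ++ replicate k t  ∎
    where open ≡-Reasoning
  ... | pastTail j 1≤j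
    rewrite dropLast-pastTail {l} {y} {b} j 1≤j | takeLast-pastTail {l} {y} {b} j 1≤j = begin
      sRun l y ++ replicate b t
        ≡⟨ cong (λ l → sRun l y ++ replicate b t) (m∸n+n≡m j≤l) ⟨
      sRun (l ∸ j + j) y ++ replicate b t
        ≡⟨ cong (_++ replicate b t) (sRun-+ (l ∸ j) j y) ⟩
      (sRun (l ∸ j) (y ∸ j) ++ sRun j y) ++ replicate b t
        ≡⟨ ++-assoc (sRun (l ∸ j) (y ∸ j)) _ _ ⟩
      sRun (l ∸ j) (y ∸ j) ++ (sRun j y ++ replicate b t)
        ≡⟨ cong (_++ _) (++-identityʳ (sRun (l ∸ j) (y ∸ j))) ⟨
      (sRun (l ∸ j) (y ∸ j) ++ []) ++ (sRun j y ++ replicate b t) ∎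
    where
    open ≡-Reasoning
    j≤l : j ≤ l
    j≤l = +-cancelʳ-≤ b j l k≤len

  dropLast-valid : ∀ c {k} → Valid c → k < len c → Valid (dropLast c k)
  dropLast-valid (code l y b) {k} (y≤2n , tail→2n , _) k<len with tailCut b k
  ... | inTail k≤b rewrite dropLast-inTail {l} {y} k≤b =
    y≤2n , (λ 1≤b∸k → tail→2n (≤-trans 1≤b∸k (m∸n≤m b k))) ,
    subst (1 ≤_) (+-∸-assoc l k≤b) (m<n⇒0<n∸m k<len)
  ... | pastTail j 1≤j rewrite dropLast-pastTail {l} {y} {b} j 1≤j =
    ≤-trans (m∸n≤m y j) y≤2n , (λ ()) ,
    ≤-trans (m<n⇒0<n∸m (+-cancelʳ-< b j l k<len)) (m≤m+n _ 0)

  takeLast-valid : ∀ c {k} → Valid c → 1 ≤ k → Valid (takeLast c k)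
  takeLast-valid (code l y b) {k} (y≤2n , tail→2n , _) 1≤k with tailCut b k
  ... | inTail k≤b rewrite takeLast-inTail {l} {y} k≤b = ≤-refl , (λ _ → refl) , 1≤k
  ... | pastTail j 1≤j rewrite takeLast-pastTail {l} {y} {b} j 1≤j =
    y≤2n , tail→2n , ≤-trans 1≤j (m≤m+n j b)

  word-nonempty : ∀ c → Valid c → word c ≢ []
  word-nonempty c (_ , _ , 1≤len) word≡[] =
    <⇒≱ 1≤len (≤-reflexive (trans (sym (length-word c)) (cong length word≡[])))

  Kᵢ : State → Kripke
  Kᵢ i = record { State = State ; δ = δₙ n ; μp = μₙ n ; init = i }

  Trace : State → List State → Set
  Trace i = IsTrace (Kᵢ i)

  toℕ≤2n : ∀ s → toℕ s ≢ 2n+1 → toℕ s ≤ 2n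
  toℕ≤2n s s≢t = ≤-pred (≤∧≢⇒< (≤-pred (toℕ<n s)) s≢t)

  δ-pred : ∀ i → i ≤ 2n+1 → δₙ n (state (pred i)) (state i)
  δ-pred zero    _          = inj₁ (refl , refl)
  δ-pred (suc i) 1+i≤2n+1 =
    inj₂ (inj₁ (trans (cong suc (toℕ-state (≤-trans (n≤1+n i) 1+i≤2n+1))) (sym (toℕ-state 1+i≤2n+1))))

  δ-pred⁻¹ : ∀ {s s'} → toℕ s' ≤ 2n → δₙ n s s' → toℕ s ≡ pred (toℕ s')
  δ-pred⁻¹ _     (inj₁ (s≡0 , s'≡0))   = trans s≡0 (cong pred (sym s'≡0))
  δ-pred⁻¹ _     (inj₂ (inj₁ 1+s≡s'))   = cong pred 1+s≡s'
  δ-pred⁻¹ s'≤2n (inj₂ (inj₂ (_ , s'≡t))) = ⊥-elim (<-irrefl s'≡t (s≤s s'≤2n))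

  δ-into-t⁻¹ : ∀ {s s'} → toℕ s' ≡ 2n+1 → δₙ n s s' → toℕ s ≡ 2n+1 ⊎ toℕ s ≡ 2n
  δ-into-t⁻¹ s'≡t (inj₁ (_ , s'≡0))       with trans (sym s'≡t) s'≡0
  ... | ()
  δ-into-t⁻¹ s'≡t (inj₂ (inj₁ 1+s≡s'))    = inj₂ (suc-injective (trans 1+s≡s' s'≡t))
  δ-into-t⁻¹ _    (inj₂ (inj₂ (s≡t , _))) = inj₁ s≡t

  t-trace : ∀ {i} b → Trace i (t ∷ replicate b t)
  t-trace zero    = single t
  t-trace (suc b) = step (inj₂ (inj₂ (toℕ-t , toℕ-t))) (t-trace b)

  word-trace : ∀ {i} c → Valid c → Trace i (word c)
  word-trace (code zero          _ (suc b)) _ = t-trace b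
  word-trace (code (suc zero)    _ zero)    _ = single _
  word-trace (code (suc zero)    _ (suc b)) (_ , tail→2n , _) rewrite tail→2n (s≤s z≤n) =
    step (δ-pred 2n+1 ≤-refl) (t-trace b)
  word-trace (code (suc (suc l)) y b)       (y≤2n , tail→2n , _) =
    step (subst (λ i → δₙ n (state i) (state (y ∸ l))) (pred[m∸n]≡m∸[1+n] y l)
                (δ-pred (y ∸ l) (m≤n⇒m≤1+n (≤-trans (m∸n≤m y l) y≤2n))))
         (word-trace (code (suc l) y b) (y≤2n , tail→2n , s≤s z≤n))

  prepend : ∀ {s s' ρ} c → Valid c → s' ∷ ρ ≡ word c → δₙ n s s' →
            Σ Code λ c⁺ → Valid c⁺ × s ∷ s' ∷ ρ ≡ word c⁺
  prepend (code zero _ zero) (_ , _ , ()) _ _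
  prepend {s} (code zero _ (suc b)) (_ , tail→2n , _) e d
    with tail→2n (s≤s z≤n) | δ-into-t⁻¹ (trans (cong toℕ (proj₁ (∷-injective e))) toℕ-t) d
  ... | refl | inj₁ s≡t  = code 0 2n (suc (suc b)) , (≤-refl , (λ _ → refl) , s≤s z≤n) ,
                           cong₂ _∷_ (sym (state-toℕ s≡t)) e
  ... | refl | inj₂ s≡2n = code 1 2n (suc b) , (≤-refl , (λ _ → refl) , s≤s z≤n) ,
                           cong₂ _∷_ (sym (state-toℕ s≡2n)) e
  prepend {s} {s'} (code (suc l) y b) (y≤2n , tail→2n , _) e d =
    code (suc (suc l)) y b , (y≤2n , tail→2n , s≤s z≤n) , cong₂ _∷_ (sym (state-toℕ s≡)) e
    where
    y∸l≤2n = ≤-trans (m∸n≤m y l) y≤2n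
    s'≡ : toℕ s' ≡ y ∸ l
    s'≡ = trans (cong toℕ (proj₁ (∷-injective e))) (toℕ-state-run l y≤2n)
    s≡ : toℕ s ≡ y ∸ suc l
    s≡ = trans (δ-pred⁻¹ (≤-trans (≤-reflexive s'≡) y∸l≤2n) d)
               (trans (cong pred s'≡) (pred[m∸n]≡m∸[1+n] y l))

  trace-code : ∀ {i ρ} → Trace i ρ → Σ Code λ c → Valid c × ρ ≡ word c
  trace-code (single s) with toℕ s ≟ 2n+1
  ... | yes s≡t = code 0 2n 1 , (≤-refl , (λ _ → refl) , s≤s z≤n) , cong (_∷ []) (sym (state-toℕ s≡t))
  ... | no  s≢t = code 1 (toℕ s) 0 , (toℕ≤2n s s≢t , (λ ()) , s≤s z≤n) , cong (_∷ []) (sym (state-toℕ refl))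
  trace-code (step d tr) with trace-code tr
  ... | c , valid , e = prepend c valid e d

  decode : List State → Code
  decode []      = code 0 2n 0
  decode (s ∷ ρ) with toℕ s ≟ 2n+1 | decode ρ
  ... | yes _ | code _ _ b       = code 0 2n (suc b)
  ... | no  _ | code zero _ b    = code 1 (toℕ s) b
  ... | no  _ | code (suc l) y b = code (suc (suc l)) y b

  decode-ts : ∀ b → decode (replicate b t) ≡ code 0 2n b
  decode-ts zero = refl
  decode-ts (suc b) with toℕ t ≟ 2n+1 | decode (replicate b t) | decode-ts b
  ... | yes _   | _ | refl = refl
  ... | no  t≢t | _ | _    = ⊥-elim (t≢t toℕ-t)

  decode-run : ∀ l y b → y ≤ 2n → decode (word (code (suc l) y b)) ≡ code (suc l) y b
  decode-run zero y b y≤2n with toℕ (state y) ≟ 2n+1 | decode (replicate b t) | decode-ts b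
  ... | yes s≡t | _ | _    = ⊥-elim (toℕ-state≢t y≤2n s≡t)
  ... | no  _   | _ | refl = cong (λ i → code 1 i b) (toℕ-state-run 0 y≤2n)
  decode-run (suc l) y b y≤2n
    with toℕ (state (y ∸ suc l)) ≟ 2n+1 | decode (word (code (suc l) y b)) | decode-run l y b y≤2n
  ... | yes s≡t | _ | _    = ⊥-elim (toℕ-state≢t (≤-trans (m∸n≤m y (suc l)) y≤2n) s≡t)
  ... | no  _   | _ | refl = refl

  decode-word : ∀ c → Valid c → decode (word c) ≡ c
  decode-word (code zero    _ zero)    (_ , _ , ())
  decode-word (code zero    _ (suc b)) (_ , tail→2n , _) rewrite tail→2n (s≤s z≤n) = decode-ts (suc b)
  decode-word (code (suc l) y b)       (y≤2n , _ , _) = decode-run l y b y≤2n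

  word-injective : ∀ {c₁ c₂} → Valid c₁ → Valid c₂ → word c₁ ≡ word c₂ → c₁ ≡ c₂
  word-injective {c₁} {c₂} valid₁ valid₂ e =
    trans (sym (decode-word c₁ valid₁)) (trans (cong decode e) (decode-word c₂ valid₂))

  len-takeLast : ∀ c {k} → k ≤ len c → len (takeLast c k) ≡ k
  len-takeLast (code l y b) {k} _ with tailCut b k
  ... | inTail k≤b rewrite takeLast-inTail {l} {y} k≤b = refl
  ... | pastTail j 1≤j rewrite takeLast-pastTail {l} {y} {b} j 1≤j = refl

  word-split-cancel : ∀ c {k σ τ} → k ≤ len c → length τ ≡ k → word c ≡ σ ++ τ →
                      σ ≡ word (dropLast c k) × τ ≡ word (takeLast c k)
  word-split-cancel c {k} {σ} k≤len |τ|≡k e =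
    ++-cancel-lengthʳ σ (word (dropLast c k))
      (trans |τ|≡k (sym (trans (length-word (takeLast c k)) (len-takeLast c k≤len))))
      (trans (sym e) (word-split c k k≤len))

  length-++-word : ∀ c σ τ → σ ++ τ ≡ word c → length σ + length τ ≡ len c
  length-++-word c σ τ e = trans (sym (length-++ σ)) (trans (cong length e) (length-word c))

  cut-word : ∀ c {σ τ} → word c ≡ σ ++ τ → σ ≢ [] → τ ≢ [] →
             ProperCut c (length τ) × σ ≡ word (dropLast c (length τ)) × τ ≡ word (takeLast c (length τ))
  cut-word c {σ} {τ} e σ≢[] τ≢[] =
    (≢[]⇒1≤length τ≢[] , k<len) , word-split-cancel c (<⇒≤ k<len) refl e
    where
    k<len : length τ < len c
    k<len = subst (length τ <_) (length-++-word c σ τ (sym e)) (m<n+m (length τ) (≢[]⇒1≤length σ≢[]))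

  extendRight-word : ∀ {i c τ} → Valid c → Trace i (word c ++ τ) → τ ≢ [] →
                     Σ Code λ c⁺ → Valid c⁺ × word c ++ τ ≡ word c⁺ × ExtendsRight c⁺ c
  extendRight-word {c = c} {τ} valid tr τ≢[] with trace-code tr
  ... | c⁺ , valid⁺ , e⁺ =
    c⁺ , valid⁺ , e⁺ , k , (≢[]⇒1≤length τ≢[] , k<len⁺) ,
    sym (word-injective valid (dropLast-valid c⁺ valid⁺ k<len⁺)
                        (proj₁ (word-split-cancel c⁺ (<⇒≤ k<len⁺) refl (sym e⁺))))
    where
    k = length τ
    k<len⁺ : k < len c⁺
    k<len⁺ = subst (k <_) (length-++-word c⁺ (word c) τ e⁺)
                   (m<n+m k (≢[]⇒1≤length (word-nonempty c valid)))

  extendLeft-word : ∀ {i c σ} → Valid c → Trace i (σ ++ word c) → σ ≢ [] →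
                    Σ Code λ c⁺ → Valid c⁺ × σ ++ word c ≡ word c⁺ × ExtendsLeft c⁺ c
  extendLeft-word {c = c} {σ} valid tr σ≢[] with trace-code tr
  ... | c⁺ , valid⁺ , e⁺ =
    c⁺ , valid⁺ , e⁺ , k , (1≤k , k<len⁺) ,
    sym (word-injective valid (takeLast-valid c⁺ valid⁺ 1≤k)
                        (proj₂ (word-split-cancel c⁺ {σ = σ} (<⇒≤ k<len⁺) refl (sym e⁺))))
    where
    k = length (word c)
    1≤k = ≢[]⇒1≤length (word-nonempty c valid)
    k<len⁺ : k < len c⁺
    k<len⁺ = subst (k <_) (length-++-word c⁺ σ (word c) e⁺) (m<n+m k (≢[]⇒1≤length σ≢[]))

  extendsRight-split : ∀ {c⁺ c} (ext : ExtendsRight c⁺ c) → word c⁺ ≡ word c ++ word (takeLast c⁺ (proj₁ ext))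
  extendsRight-split {c⁺} (k , (_ , k<len⁺) , refl) = word-split c⁺ k (<⇒≤ k<len⁺)

  extendsLeft-split : ∀ {c⁺ c} (ext : ExtendsLeft c⁺ c) → word c⁺ ≡ word (dropLast c⁺ (proj₁ ext)) ++ word c
  extendsLeft-split {c⁺} (k , (_ , k<len⁺) , refl) = word-split c⁺ k (<⇒≤ k<len⁺)

  _⊨[_]_ : List State → State → HS → Set
  ρ ⊨[ i ] ψ = _⊨_ (Kᵢ i) ρ ψ

  -- Satisfaction ignores the initial state but its type mentions it, hence i and j.
  Invariant : ℕ → HS → Set
  Invariant m ψ = ∀ {c c'} → Valid c → Valid c' → c ≈ᶜ[ m ] c' →
                  ∀ i j → word c ⊨[ i ] ψ → word c' ⊨[ j ] ψ

  invariant-weaken : ∀ {h m ψ} → h ≤ m → Invariant h ψ → Invariant m ψ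
  invariant-weaken h≤m inv valid valid' r = inv valid valid' (≈ᶜ-weaken h≤m r)

  invariant-p : Invariant 1 p
  invariant-p {code zero _ _} {code l' _ b'} _ _ (l≈ , _) _ _ _ rewrite ≈-zero ≤-refl l≈ =
    replicate⁺ b' toℕ-t
  invariant-p {code (suc l) y _} (y≤2n , _) _ _ _ _ (s≡t ∷ _) =
    ⊥-elim (toℕ-state≢t (≤-trans (m∸n≤m y l) y≤2n) s≡t)

  invariant-¬ : ∀ {m ψ} → Invariant m ψ → Invariant m (¬' ψ)
  invariant-¬ inv valid valid' r i j ¬sat sat' = ¬sat (inv valid' valid (≈ᶜ-sym r) j i sat')

  invariant-∧ : ∀ {m ψ φ} → Invariant m ψ → Invariant m φ → Invariant m (ψ ∧' φ)
  invariant-∧ inv₁ inv₂ valid valid' r i j (sat₁ , sat₂) =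
    inv₁ valid valid' r i j sat₁ , inv₂ valid valid' r i j sat₂

  invariant-E : ∀ {h m θ} → 1 ≤ h → suc h ≤ m → Invariant h θ → Invariant m (⟨E⟩ θ)
  invariant-E {θ = θ} 1≤h 1+h≤m inv {c} {c'} valid valid' r i j (σ , τ , σ≢[] , τ≢[] , e , sat)
    with cut-word c e σ≢[] τ≢[]
  ... | cut@(1≤k , _) , _ , τ≡ with takeLast-move c c' 1≤h 1+h≤m r cut
  ...   | k' , cut'@(1≤k' , k'<len') , r' =
    word (dropLast c' k') , word (takeLast c' k') ,
    word-nonempty _ (dropLast-valid c' valid' k'<len') , word-nonempty _ (takeLast-valid c' valid' 1≤k') ,
    word-split c' k' (<⇒≤ k'<len') ,
    inv (takeLast-valid c valid 1≤k) (takeLast-valid c' valid' 1≤k') r' i j (subst (_⊨[ i ] θ) τ≡ sat)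

  invariant-B : ∀ {h m θ₁ θ₂} → 1 ≤ h → h + h < m → h ≤ 2n+1 →
                Invariant h θ₁ → Invariant h θ₂ → Invariant m (⟨B⟩ (θ₁ ∧' θ₂))
  invariant-B {θ₁ = θ₁} {θ₂} 1≤h 2h<m h≤2n+1 inv₁ inv₂ {c} {c'} valid valid' r i j
    (σ , τ , σ≢[] , τ≢[] , e , sat₁ , sat₂) with cut-word c e σ≢[] τ≢[]
  ... | cut@(_ , k<len) , σ≡ , _ with dropLast-move c c' 1≤h 2h<m h≤2n+1 valid valid' r cut
  ...   | k' , (1≤k' , k'<len') , r' =
    word (dropLast c' k') , word (takeLast c' k') ,
    word-nonempty _ valid⁻' , word-nonempty _ (takeLast-valid c' valid' 1≤k') ,
    word-split c' k' (<⇒≤ k'<len') ,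
    inv₁ valid⁻ valid⁻' r' i j (subst (_⊨[ i ] θ₁) σ≡ sat₁) ,
    inv₂ valid⁻ valid⁻' r' i j (subst (_⊨[ i ] θ₂) σ≡ sat₂)
    where
    valid⁻  = dropLast-valid c valid k<len
    valid⁻' = dropLast-valid c' valid' k'<len'

  invariant-B̄ : ∀ {h m θ₁ θ₂} → 1 ≤ h → h + h < m → h ≤ 2n+1 →
                Invariant h θ₁ → Invariant h θ₂ → Invariant m (⟨B̄⟩ (θ₁ ∧' θ₂))
  invariant-B̄ {θ₁ = θ₁} {θ₂} 1≤h 2h<m h≤2n+1 inv₁ inv₂ valid valid' r i j
    (τ , τ≢[] , tr , sat₁ , sat₂) with extendRight-word valid tr τ≢[]
  ... | c⁺ , valid⁺ , e⁺ , ext with extendRight-move c⁺ 1≤h 2h<m h≤2n+1 valid' valid⁺ r ext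
  ...   | c⁺' , valid⁺' , ext'@(k' , (1≤k' , _) , _) , r⁺ =
    word (takeLast c⁺' k') , word-nonempty _ (takeLast-valid c⁺' valid⁺' 1≤k') ,
    subst (Trace j) split' (word-trace c⁺' valid⁺') ,
    subst (_⊨[ j ] θ₁) split' (inv₁ valid⁺ valid⁺' r⁺ i j (subst (_⊨[ i ] θ₁) e⁺ sat₁)) ,
    subst (_⊨[ j ] θ₂) split' (inv₂ valid⁺ valid⁺' r⁺ i j (subst (_⊨[ i ] θ₂) e⁺ sat₂))
    where
    split' = extendsRight-split ext'

  invariant-Ē : ∀ {m θ} → 1 ≤ m → Invariant m θ → Invariant m (⟨Ē⟩ θ)
  invariant-Ē {θ = θ} 1≤m inv valid valid' r i j (σ , σ≢[] , tr , sat) with extendLeft-word valid tr σ≢[]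
  ... | c⁺ , valid⁺ , e⁺ , ext with extendLeft-move c⁺ 1≤m valid' valid⁺ r ext
  ...   | c⁺' , valid⁺' , ext'@(k' , (_ , k'<len⁺') , _) , r⁺ =
    word (dropLast c⁺' k') , word-nonempty _ (dropLast-valid c⁺' valid⁺' k'<len⁺') ,
    subst (Trace j) split' (word-trace c⁺' valid⁺') ,
    subst (_⊨[ j ] θ) split' (inv valid⁺ valid⁺' r⁺ i j (subst (_⊨[ i ] θ) e⁺ sat))
    where
    split' = extendsLeft-split ext'

  size-pos : ∀ ψ → 1 ≤ size ψ
  size-pos p        = s≤s z≤n
  size-pos (¬' _)   = s≤s z≤n
  size-pos (_ ∧' _) = s≤s z≤n
  size-pos (⟨B⟩ _)  = s≤s z≤n
  size-pos (⟨E⟩ _)  = s≤s z≤n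
  size-pos (⟨B̄⟩ _)  = s≤s z≤n
  size-pos (⟨Ē⟩ _)  = s≤s z≤n

  balanced-bounds : ∀ {h₁ h₂} → h₁ ≡ h₂ →
                    h₁ + h₁ < 2 + (h₁ + h₂) × h₁ ≤ 2 + (h₁ + h₂) × h₂ ≤ 2 + (h₁ + h₂)
  balanced-bounds {h} refl = 2h<2+2h , h≤2+2h , h≤2+2h
    where
    2h<2+2h = m<n⇒m<1+n (n<1+n (h + h))
    h≤2+2h  = ≤-trans (m≤m+n h h) (<⇒≤ 2h<2+2h)

  invariant : ∀ ψ → Balanced ψ → size ψ ≤ 2n+1 → Invariant (size ψ) ψ
  invariant p _ _ = invariant-p
  invariant (¬' ψ) bal |ψ|≤ =
    invariant-weaken (n≤1+n _) (invariant-¬ (invariant ψ bal (≤-trans (n≤1+n _) |ψ|≤)))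
  invariant (ψ ∧' φ) (bal₁ , bal₂) |ψ∧φ|≤ =
    invariant-∧ (invariant-weaken |ψ|≤ (invariant ψ bal₁ (≤-trans |ψ|≤ |ψ∧φ|≤)))
                (invariant-weaken |φ|≤ (invariant φ bal₂ (≤-trans |φ|≤ |ψ∧φ|≤)))
    where
    |ψ|≤ = ≤-trans (m≤m+n (size ψ) (size φ)) (n≤1+n _)
    |φ|≤ = ≤-trans (m≤n+m (size φ) (size ψ)) (n≤1+n _)
  invariant (⟨B⟩ (θ₁ ∧' θ₂)) (|θ₁|≡|θ₂| , bal₁ , bal₂) |B|≤ with balanced-bounds |θ₁|≡|θ₂|
  ... | 2h<m , |θ₁|≤ , |θ₂|≤ =
    invariant-B (size-pos θ₁) 2h<m (≤-trans |θ₁|≤ |B|≤)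
      (invariant θ₁ bal₁ (≤-trans |θ₁|≤ |B|≤))
      (subst (λ h → Invariant h θ₂) (sym |θ₁|≡|θ₂|) (invariant θ₂ bal₂ (≤-trans |θ₂|≤ |B|≤)))
  invariant (⟨B̄⟩ (θ₁ ∧' θ₂)) (|θ₁|≡|θ₂| , bal₁ , bal₂) |B̄|≤ with balanced-bounds |θ₁|≡|θ₂|
  ... | 2h<m , |θ₁|≤ , |θ₂|≤ =
    invariant-B̄ (size-pos θ₁) 2h<m (≤-trans |θ₁|≤ |B̄|≤)
      (invariant θ₁ bal₁ (≤-trans |θ₁|≤ |B̄|≤))
      (subst (λ h → Invariant h θ₂) (sym |θ₁|≡|θ₂|) (invariant θ₂ bal₂ (≤-trans |θ₂|≤ |B̄|≤)))
  invariant (⟨E⟩ θ) bal |E|≤ = invariant-E (size-pos θ) ≤-refl (invariant θ bal (≤-trans (n≤1+n _) |E|≤))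
  invariant (⟨Ē⟩ θ) bal |Ē|≤ =
    invariant-weaken {ψ = ⟨Ē⟩ θ} (n≤1+n _)
      (invariant-Ē (size-pos θ) (invariant θ bal (≤-trans (n≤1+n _) |Ē|≤)))
  invariant (⟨B⟩ p)         (() , _)
  invariant (⟨B⟩ (¬' _))    (() , _)
  invariant (⟨B⟩ (⟨B⟩ _))   (() , _)
  invariant (⟨B⟩ (⟨E⟩ _))   (() , _)
  invariant (⟨B⟩ (⟨B̄⟩ _))   (() , _)
  invariant (⟨B⟩ (⟨Ē⟩ _))   (() , _)
  invariant (⟨B̄⟩ p)         (() , _)
  invariant (⟨B̄⟩ (¬' _))    (() , _)
  invariant (⟨B̄⟩ (⟨B⟩ _))   (() , _)
  invariant (⟨B̄⟩ (⟨E⟩ _))   (() , _)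
  invariant (⟨B̄⟩ (⟨B̄⟩ _))   (() , _)
  invariant (⟨B̄⟩ (⟨Ē⟩ _))   (() , _)

  s₀ s₁ : State
  s₀ = fzero
  s₁ = fsuc fzero

  initial-s₀ : ∀ l y b → y ≤ l → IsInitial (Kᵢ s₀) (word (code (suc l) y b))
  initial-s₀ l y b y≤l = _ , cong (λ i → state i ∷ sRun l y ++ replicate b t) (m≤n⇒m∸n≡0 y≤l)

  initial-s₁ : ∀ y b → 1 ≤ y → IsInitial (Kᵢ s₁) (word (code y y b))
  initial-s₁ (suc l) b _ = _ , cong (λ i → state i ∷ sRun l (suc l) ++ replicate b t) (m+n∸n≡m 1 l)

  initial-s₀⁻¹ : ∀ c {ρ} → Valid c → word c ≡ s₀ ∷ ρ →
                 Σ ℕ λ l → Σ ℕ λ y → Σ ℕ λ b → y ≤ l × c ≡ code (suc l) y b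
  initial-s₀⁻¹ (code zero    _ (suc _)) _ e with trans (sym toℕ-t) (cong toℕ (proj₁ (∷-injective e)))
  ... | ()
  initial-s₀⁻¹ (code (suc l) y b) (y≤2n , _) e =
    l , y , b , m∸n≡0⇒m≤n (trans (sym (toℕ-state-run l y≤2n)) (cong toℕ (proj₁ (∷-injective e)))) , refl

  initial-s₁⁻¹ : 1 ≤ n → ∀ c {ρ} → Valid c → word c ≡ s₁ ∷ ρ → Σ ℕ λ l → Σ ℕ λ b → c ≡ code (suc l) (suc l) b
  initial-s₁⁻¹ 1≤n (code zero _ (suc _)) _ e with trans (sym toℕ-t) (cong toℕ (proj₁ (∷-injective e)))
  ... | 2n+1≡1 = ⊥-elim (<-irrefl (sym (suc-injective 2n+1≡1)) (≤-trans 1≤n n≤2n))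
  initial-s₁⁻¹ _ (code (suc l) y b) (y≤2n , _) e =
    l , b , cong (λ y → code (suc l) y b)
                 (m∸n≡1⇒m≡1+n y l (trans (sym (toℕ-state-run l y≤2n)) (cong toℕ (proj₁ (∷-injective e)))))

  Partners : State → State → Set
  Partners i j = ∀ c → Valid c → IsInitial (Kᵢ j) (word c) →
                 Σ Code λ c' → Valid c' × c' ≈ᶜ[ n ] c × IsInitial (Kᵢ i) (word c')

  transfer : ∀ {i j ψ} → Partners i j → Balanced ψ → size ψ ≤ n → _⊨st_ (Kᵢ i) ψ → _⊨st_ (Kᵢ j) ψ
  transfer {i} {j} {ψ} partners bal |ψ|≤n sat-i _ tr init with trace-code tr
  ... | c , valid , refl with partners c valid init
  ...   | c' , valid' , c'≈c , init' =
    invariant-weaken |ψ|≤n (invariant ψ bal (≤-trans |ψ|≤n n≤2n+1)) valid' valid c'≈c i j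
      (sat-i (word c') (word-trace c' valid') init')
    where
    n≤2n+1 = m≤n⇒m≤1+n n≤2n

  ≤n⇒far : ∀ {x} → x ≤ n → x + n ≤ 2n+1
  ≤n⇒far x≤n = ≤-trans (+-monoˡ-≤ n x≤n) (m≤n⇒m≤1+n (≤-reflexive (cong (n +_) (sym (+-identityʳ n)))))

  no-tail-below-n : ∀ {y b} → (1 ≤ b → y ≡ 2n) → ¬ n ≤ y → b ≡ 0
  no-tail-below-n {b = zero}  _       _   = refl
  no-tail-below-n {b = suc _} tail→2n n≰y =
    ⊥-elim (n≰y (≤-trans n≤2n (≤-reflexive (sym (tail→2n (s≤s z≤n))))))

  s₀-partners : 1 ≤ n → Partners s₀ s₁
  s₀-partners 1≤n c valid (_ , e) with initial-s₁⁻¹ 1≤n c valid e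
  s₀-partners 1≤n c (y≤2n , tail→2n , _) _ | l , b , refl with n ≤? suc l
  ... | yes n≤1+l =
    code (suc (suc l)) (suc l) b , (y≤2n , tail→2n , s≤s z≤n) ,
    (inj₂ (≤-trans n≤1+l (n≤1+n _) , n≤1+l) , inj₁ refl , inj₁ refl) , initial-s₀ (suc l) (suc l) b ≤-refl
  ... | no  n≰1+l with no-tail-below-n tail→2n n≰1+l
  ...   | refl =
    code (suc l) l 0 , (≤-trans (n≤1+n l) y≤2n , (λ ()) , s≤s z≤n) ,
    (inj₁ refl , inj₁ refl , inj₂ (≤n⇒far (≤-trans (n≤1+n l) 1+l≤n) , ≤n⇒far 1+l≤n)) ,
    initial-s₀ l l 0 ≤-refl
    where
    1+l≤n = <⇒≤ (≰⇒> n≰1+l)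

  s₁-partners : 1 ≤ n → Partners s₁ s₀
  s₁-partners _ c valid (_ , e) with initial-s₀⁻¹ c valid e
  s₁-partners 1≤n c (y≤2n , tail→2n , _) _ | l , y , b , y≤l , refl with n ≤? y
  ... | yes n≤y =
    code y y b , (y≤2n , tail→2n , ≤-trans 1≤y (m≤m+n y b)) ,
    (inj₂ (n≤y , ≤-trans n≤y (≤-trans y≤l (n≤1+n l))) , inj₁ refl , inj₁ refl) , initial-s₁ y b 1≤y
    where
    1≤y = ≤-trans 1≤n n≤y
  ... | no  n≰y with no-tail-below-n tail→2n n≰y
  ...   | refl =
    code z z 0 , (≤-trans z≤n' n≤2n , (λ ()) , ≤-trans 1≤z (m≤m+n z 0)) ,
    (⊓-≈ (suc l) n , inj₁ refl , inj₂ (≤n⇒far z≤n' , ≤n⇒far (<⇒≤ (≰⇒> n≰y)))) , initial-s₁ z 0 1≤z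
    where
    z = suc l ⊓ n
    z≤n' = m⊓n≤n (suc l) n
    1≤z = ⊓-glb (s≤s z≤n) 1≤n

lemma40 : (n : ℕ) → 1 ≤ n → (ψ : HS) → Balanced ψ → size ψ ≤ n →
    (_⊨st_ (K n) ψ ⇔ _⊨st_ (M n) ψ)
lemma40 n 1≤n ψ bal |ψ|≤n =
  mk⇔ (transfer (s₀-partners 1≤n) bal |ψ|≤n) (transfer (s₁-partners 1≤n) bal |ψ|≤n)
  where open Chain n
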